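{- For $k\ge0$, $$W_{112\text{ - }1}(x;k)=1+\sum_{j=0}^{k-1}\left(\sum_{i=j}^{k-1}\binom{i}{j}(1-x^2)^{i-j}\right)x^{2j+1}W_{112\text{ - }1}(x;k-j).$$
   Context: For $k\ge1$ let $[k]=\{1,\dots,k\}$; a $k$-ary word of length $n$ is an element of $[k]^n$ ($[0]^n$ is empty for $n\ge1$, and the empty word is the unique word of length $0$). Two words are order-isomorphic if replacing the $i$-th smallest distinct letter by $i$ yields the same word. A word $w=w_1\cdots w_n$ contains the vincular pattern $112\text{ - }1$ if there are indices $p$ and $q\ge p+3$ with $w_pw_{p+1}w_{p+2}w_q$ order-isomorphic to $1121$; otherwise it avoids it. $a_{112\text{ - }1}(n,k)$ is the number of words in $[k]^n$ avoiding it, and $W_{112\text{ - }1}(x;k)=\sum_{n\ge0}a_{112\text{ - }1}(n,k)x^n$. An empty sum equals $0$. -}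

module Defs where

open import Data.Nat using (ℕ; zero; suc; _+_; _∸_; _≡ᵇ_; _<ᵇ_)
open import Data.Nat.Combinatorics using (_C_)
open import Data.Integer as ℤ using (ℤ; +_; -_)
open import Data.Bool using (Bool; true; false; _∧_; _∨_; if_then_else_)
open import Data.List using (List; []; _∷_; map; concatMap; sum; upTo; foldr; length; filter)
open import Data.Fin using (Fin; toℕ)
open import Data.List using (allFin)
open import Data.Bool.ListAction using (any)

-- All k-ary words of length n; letter i ∈ Fin k stands for the letter i+1 ∈ [k].
-- (Shifting all letters by 1 does not affect order-isomorphism.)
words : (k n : ℕ) → List (List ℕ)
words k zero    = [] ∷ []
words k (suc n) = concatMap (λ (a : Fin k) → map (toℕ a ∷_) (words k n)) (allFin k)

-- containsVinc w = true iff there are positions p and q ≥ p+3 with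
-- w_p w_{p+1} w_{p+2} w_q order-isomorphic to 1121, i.e.
-- w_p = w_{p+1} < w_{p+2} and w_q = w_p.
containsVinc : List ℕ → Bool
containsVinc (a ∷ b ∷ c ∷ rest) =
  ((a ≡ᵇ b) ∧ (a <ᵇ c) ∧ any (a ≡ᵇ_) rest) ∨ containsVinc (b ∷ c ∷ rest)
containsVinc _ = false

avoids : List ℕ → Bool
avoids w = if containsVinc w then false else true

a112-1 : ℕ → ℕ → ℕ
a112-1 n k = length (filter (λ w → Data.Bool.T? (avoids w)) (words k n))
  where import Data.Bool

PS : Set
PS = ℕ → ℤ

𝟙 : PS
𝟙 zero    = + 1
𝟙 (suc _) = + 0

𝟘 : PS
𝟘 _ = + 0

X^ : ℕ → PS
X^ m n = if m ≡ᵇ n then + 1 else + 0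

infixl 6 _⊕_
infixl 7 _⊛_ _·_

_⊕_ : PS → PS → PS
(f ⊕ g) n = f n ℤ.+ g n

_·_ : ℤ → PS → PS
(c · f) n = c ℤ.* f n

⊝ : PS → PS
⊝ f n = - f n

_⊛_ : PS → PS → PS
(f ⊛ g) n = foldr ℤ._+_ (+ 0) (map (λ i → f i ℤ.* g (n ∸ i)) (upTo (suc n)))

_^ₚ_ : PS → ℕ → PS
f ^ₚ zero  = 𝟙
f ^ₚ suc m = f ⊛ (f ^ₚ m)

Σₚ : {A : Set} → List A → (A → PS) → PS
Σₚ xs F = foldr (λ a acc → F a ⊕ acc) 𝟘 xs

range : ℕ → ℕ → List ℕ
range j k = map (λ t → j + t) (upTo (k ∸ j))

W : ℕ → PS
W k n = + (a112-1 n k)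

1-x² : PS
1-x² = 𝟙 ⊕ ⊝ (X^ 2)

module Submission where

-- Let H_k(a; x) count the words w over [k] for which a w avoids 112-1. Sorting by the next one or two
-- letters gives linear relations between the H_k(a) and the counts P_k(a) for a a w; a third letter
-- c > a forbids every later a, so the rest of the word lives over [k] with a removed, i.e. over [k-1].
-- Eliminating P leaves H_{k+1}(a; N+2) + H_{k+1}(a+1; N) = H_{k+1}(a+1; N+2) + H_k(a; N). For
-- G_{i,k} = x H_k(k-1-i) this reads G_{i+1,k+1} = (1 - x²) G_{i,k+1} + x² G_{i,k}, with G_{0,k} = x W(x;k)
-- since any word may follow the largest letter. By Pascal's rule
-- G_{i,k} = Σ_j C(i,j) (1 - x²)^(i-j) x^(2j+1) W(x;k-j), and W(x;k) = 1 + Σ_i G_{i,k}.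

open import Defs

module Words where

  open import Data.Bool using (Bool; true; false; not; _∧_; _∨_; if_then_else_)
  open import Data.Bool.ListAction using (any)
  open import Data.Bool.Properties using (T-≡; ∧-identityʳ; ∧-zeroʳ)
  open import Data.Fin using (Fin; toℕ)
  open import Data.List using (List; []; _∷_; _++_; map; concatMap; length; filter; tabulate)
  open import Data.Nat using (ℕ; zero; suc; _+_; _∸_; _≡ᵇ_; _<ᵇ_; _<_; _≤_; z≤n; s≤s; _≟_)
  open import Data.Nat.Properties
  open import Algebra.Properties.CommutativeSemigroup +-commutativeSemigroup using (interchange; x∙yz≈xz∙y; xy∙z≈xz∙y)
  open import Data.Nat.Tactic.RingSolver using (solve-∀)
  open import Function using (_∘_)
  open import Function.Bundles using (Equivalence)
  open import Relation.Binary.Definitions using (tri<; tri≈; tri>)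
  open import Relation.Binary.PropositionalEquality
  open import Relation.Nullary using (¬_; yes; no; contradiction)
  open import Relation.Nullary.Decidable.Core using (T?)

  sumℕ : ℕ → (ℕ → ℕ) → ℕ
  sumℕ zero    F = 0
  sumℕ (suc k) F = F 0 + sumℕ k (F ∘ suc)

  sumℕ-cong : ∀ k {F G : ℕ → ℕ} → (∀ i → i < k → F i ≡ G i) → sumℕ k F ≡ sumℕ k G
  sumℕ-cong zero    F≡G = refl
  sumℕ-cong (suc k) F≡G = cong₂ _+_ (F≡G 0 (s≤s z≤n)) (sumℕ-cong k (λ i i<k → F≡G (suc i) (s≤s i<k)))

  sumℕ-distrib-+ : ∀ k (F G : ℕ → ℕ) → sumℕ k (λ i → F i + G i) ≡ sumℕ k F + sumℕ k G
  sumℕ-distrib-+ zero    F G = refl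
  sumℕ-distrib-+ (suc k) F G =
    trans (cong (F 0 + G 0 +_) (sumℕ-distrib-+ k (F ∘ suc) (G ∘ suc)))
          (interchange (F 0) (G 0) (sumℕ k (F ∘ suc)) (sumℕ k (G ∘ suc)))

  sumℕ-zero : ∀ k → sumℕ k (λ _ → 0) ≡ 0
  sumℕ-zero zero    = refl
  sumℕ-zero (suc k) = sumℕ-zero k

  sumℕ-delta : ∀ {k a} (F : ℕ → ℕ) → a < k → sumℕ k (λ b → if b ≡ᵇ a then F b else 0) ≡ F a
  sumℕ-delta {suc k} {zero}  F _         = trans (cong (F 0 +_) (sumℕ-zero k)) (+-identityʳ (F 0))
  sumℕ-delta {suc k} {suc a} F (s≤s a<k) = sumℕ-delta (F ∘ suc) a<k

  sumℕ-snoc : ∀ k (F : ℕ → ℕ) → sumℕ (suc k) F ≡ sumℕ k F + F k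
  sumℕ-snoc zero    F = +-comm (F 0) 0
  sumℕ-snoc (suc k) F = trans (cong (F 0 +_) (sumℕ-snoc k (F ∘ suc))) (sym (+-assoc (F 0) _ _))

  sumℕ-reverse : ∀ k (F : ℕ → ℕ) → sumℕ k (λ i → F (k ∸ suc i)) ≡ sumℕ k F
  sumℕ-reverse zero    F = refl
  sumℕ-reverse (suc k) F =
    trans (cong (F k +_) (sumℕ-reverse k F)) (trans (+-comm (F k) _) (sym (sumℕ-snoc k F)))

  count : (List ℕ → Bool) → ℕ → ℕ → ℕ
  count p k zero    = if p [] then 1 else 0
  count p k (suc n) = sumℕ k (λ b → count (p ∘ (b ∷_)) k n)

  count-cong : ∀ k n {p q : List ℕ → Bool} → (∀ w → p w ≡ q w) → count p k n ≡ count q k n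
  count-cong k zero    p≡q rewrite p≡q [] = refl
  count-cong k (suc n) p≡q = sumℕ-cong k (λ b _ → count-cong k n (p≡q ∘ (b ∷_)))

  count-false : ∀ k n → count (λ _ → false) k n ≡ 0
  count-false k zero    = refl
  count-false k (suc n) = trans (sumℕ-cong k (λ _ _ → count-false k n)) (sumℕ-zero k)

  countList : (List ℕ → Bool) → List (List ℕ) → ℕ
  countList p []       = 0
  countList p (w ∷ ws) = (if p w then 1 else 0) + countList p ws

  length-filter≡countList : ∀ p ws → length (filter (λ w → T? (p w)) ws) ≡ countList p ws
  length-filter≡countList p []       = refl
  length-filter≡countList p (w ∷ ws) with p w
  ... | true  = cong suc (length-filter≡countList p ws)
  ... | false = length-filter≡countList p ws

  countList-++ : ∀ p us vs → countList p (us ++ vs) ≡ countList p us + countList p vs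
  countList-++ p []       vs = refl
  countList-++ p (u ∷ us) vs =
    trans (cong (_ +_) (countList-++ p us vs)) (sym (+-assoc (if p u then 1 else 0) _ _))

  countList-map-∷ : ∀ p b ws → countList p (map (b ∷_) ws) ≡ countList (p ∘ (b ∷_)) ws
  countList-map-∷ p b []       = refl
  countList-map-∷ p b (w ∷ ws) = cong (_ +_) (countList-map-∷ p b ws)

  countList-tabulate : ∀ {k m} p (h : Fin k → Fin m) (g : ℕ → ℕ) ws →
    (∀ i → toℕ (h i) ≡ g (toℕ i)) →
    countList p (concatMap (λ (b : Fin m) → map (toℕ b ∷_) ws) (tabulate h))
      ≡ sumℕ k (λ i → countList (p ∘ (g i ∷_)) ws)
  countList-tabulate {zero}  p h g ws h≗g = refl
  countList-tabulate {suc k} p h g ws h≗g =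
    trans (countList-++ p (map (toℕ (h Fin.zero) ∷_) ws) _)
      (cong₂ _+_
        (trans (countList-map-∷ p _ ws) (cong (λ b → countList (p ∘ (b ∷_)) ws) (h≗g Fin.zero)))
        (countList-tabulate p (h ∘ Fin.suc) (g ∘ suc) ws (h≗g ∘ Fin.suc)))
    where import Data.Fin as Fin

  countList-words : ∀ p k n → countList p (words k n) ≡ count p k n
  countList-words p k zero    = +-identityʳ _
  countList-words p k (suc n) =
    trans (countList-tabulate {k} p (λ i → i) (λ i → i) (words k n) (λ _ → refl))
          (sumℕ-cong k (λ b _ → countList-words (p ∘ (b ∷_)) k n))

  a112-1≡count : ∀ n k → a112-1 n k ≡ count avoids k n
  a112-1≡count n k = trans (length-filter≡countList avoids (words k n)) (countList-words avoids k n)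

  ≡ᵇ-refl : ∀ a → (a ≡ᵇ a) ≡ true
  ≡ᵇ-refl a = Equivalence.to T-≡ (≡⇒≡ᵇ a a refl)

  ≢⇒≡ᵇ≡false : ∀ {a b} → ¬ a ≡ b → (a ≡ᵇ b) ≡ false
  ≢⇒≡ᵇ≡false {zero}  {zero}  a≢b = contradiction refl a≢b
  ≢⇒≡ᵇ≡false {zero}  {suc b} a≢b = refl
  ≢⇒≡ᵇ≡false {suc a} {zero}  a≢b = refl
  ≢⇒≡ᵇ≡false {suc a} {suc b} a≢b = ≢⇒≡ᵇ≡false (a≢b ∘ cong suc)

  <⇒<ᵇ≡true : ∀ {a b} → a < b → (a <ᵇ b) ≡ true
  <⇒<ᵇ≡true a<b = Equivalence.to T-≡ (<⇒<ᵇ a<b)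

  ≤⇒>ᵇ≡false : ∀ {a b} → b ≤ a → (a <ᵇ b) ≡ false
  ≤⇒>ᵇ≡false {a}     {zero}  _         = refl
  ≤⇒>ᵇ≡false {suc a} {suc b} (s≤s b≤a) = ≤⇒>ᵇ≡false b≤a

  punchIn : ℕ → ℕ → ℕ
  punchIn a c = if c <ᵇ a then c else suc c

  punchIn-suc : ∀ a c → punchIn (suc a) (suc c) ≡ suc (punchIn a c)
  punchIn-suc a c with c <ᵇ a
  ... | true  = refl
  ... | false = refl

  punchIn-≡ᵇ : ∀ a x y → (punchIn a x ≡ᵇ punchIn a y) ≡ (x ≡ᵇ y)
  punchIn-≡ᵇ zero    x       y       = refl
  punchIn-≡ᵇ (suc a) zero    zero    = refl
  punchIn-≡ᵇ (suc a) zero    (suc y) rewrite punchIn-suc a y = refl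
  punchIn-≡ᵇ (suc a) (suc x) zero    rewrite punchIn-suc a x = refl
  punchIn-≡ᵇ (suc a) (suc x) (suc y) rewrite punchIn-suc a x | punchIn-suc a y = punchIn-≡ᵇ a x y

  punchIn-<ᵇ : ∀ a x y → (punchIn a x <ᵇ punchIn a y) ≡ (x <ᵇ y)
  punchIn-<ᵇ zero    x       y       = refl
  punchIn-<ᵇ (suc a) zero    zero    = refl
  punchIn-<ᵇ (suc a) zero    (suc y) rewrite punchIn-suc a y = refl
  punchIn-<ᵇ (suc a) (suc x) zero    = refl
  punchIn-<ᵇ (suc a) (suc x) (suc y) rewrite punchIn-suc a x | punchIn-suc a y = punchIn-<ᵇ a x y

  any-≡ᵇ-map-punchIn : ∀ a x ws → any (punchIn a x ≡ᵇ_) (map (punchIn a) ws) ≡ any (x ≡ᵇ_) ws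
  any-≡ᵇ-map-punchIn a x []       = refl
  any-≡ᵇ-map-punchIn a x (y ∷ ws) = cong₂ _∨_ (punchIn-≡ᵇ a x y) (any-≡ᵇ-map-punchIn a x ws)

  containsVinc-map-punchIn : ∀ a w → containsVinc (map (punchIn a) w) ≡ containsVinc w
  containsVinc-map-punchIn a []          = refl
  containsVinc-map-punchIn a (x ∷ [])    = refl
  containsVinc-map-punchIn a (x ∷ y ∷ []) = refl
  containsVinc-map-punchIn a (x ∷ y ∷ z ∷ w) =
    cong₂ _∨_ (cong₂ _∧_ (punchIn-≡ᵇ a x y) (cong₂ _∧_ (punchIn-<ᵇ a x z) (any-≡ᵇ-map-punchIn a x w)))
              (containsVinc-map-punchIn a (y ∷ z ∷ w))

  avoids-cong : ∀ {x y : Bool} → x ≡ y → (if x then false else true) ≡ (if y then false else true)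
  avoids-cong = cong (λ b → if b then false else true)

  avoids-map-punchIn : ∀ a w → avoids (map (punchIn a) w) ≡ avoids w
  avoids-map-punchIn a w = avoids-cong (containsVinc-map-punchIn a w)

  omits : ℕ → List ℕ → Bool
  omits a w = not (any (a ≡ᵇ_) w)

  sumℕ-punchIn : ∀ {a k} (F : ℕ → ℕ) → a ≤ k →
    sumℕ (suc k) (λ b → if b ≡ᵇ a then 0 else F b) ≡ sumℕ k (F ∘ punchIn a)
  sumℕ-punchIn {zero}          F _         = refl
  sumℕ-punchIn {suc a} {suc k} F (s≤s a≤k) =
    cong (F 0 +_) (trans (sumℕ-punchIn (F ∘ suc) a≤k)
                         (sumℕ-cong k (λ c _ → cong F (sym (punchIn-suc a c)))))

  count-omits : ∀ {a k} → a ≤ k → ∀ n (p : List ℕ → Bool) →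
    count (λ w → p w ∧ omits a w) (suc k) n ≡ count (p ∘ map (punchIn a)) k n
  count-omits a≤k zero    p rewrite ∧-identityʳ (p []) = refl
  count-omits {a} {k} a≤k (suc n) p =
    trans (sumℕ-cong (suc k) (λ b _ → first-letter b))
      (trans (sumℕ-punchIn (λ b → count (λ w → p (b ∷ w) ∧ omits a w) (suc k) n) a≤k)
             (sumℕ-cong k (λ c _ → count-omits a≤k n (p ∘ (punchIn a c ∷_)))))
    where
    first-letter : ∀ b → count (λ w → p (b ∷ w) ∧ omits a (b ∷ w)) (suc k) n
                       ≡ (if b ≡ᵇ a then 0 else count (λ w → p (b ∷ w) ∧ omits a w) (suc k) n)
    first-letter b with b ≟ a
    ... | yes refl rewrite ≡ᵇ-refl b =
      trans (count-cong (suc k) n (λ w → ∧-zeroʳ (p (b ∷ w)))) (count-false (suc k) n)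
    ... | no b≢a rewrite ≢⇒≡ᵇ≡false b≢a | ≢⇒≡ᵇ≡false (b≢a ∘ sym) = refl

  H P : ℕ → ℕ → ℕ → ℕ
  H k a = count (λ w → avoids (a ∷ w)) k
  P k a = count (λ w → avoids (a ∷ a ∷ w)) k

  containsVinc-≢ : ∀ {a b} w → ¬ a ≡ b → containsVinc (a ∷ b ∷ w) ≡ containsVinc (b ∷ w)
  containsVinc-≢ []      a≢b = refl
  containsVinc-≢ (c ∷ w) a≢b rewrite ≢⇒≡ᵇ≡false a≢b = refl

  containsVinc-≮ : ∀ {a c} w → ¬ a < c → containsVinc (a ∷ a ∷ c ∷ w) ≡ containsVinc (a ∷ c ∷ w)
  containsVinc-≮ {a} w a≮c rewrite ≡ᵇ-refl a | ≤⇒>ᵇ≡false (≮⇒≥ a≮c) = refl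

  avoids-< : ∀ {a c} w → a < c → avoids (a ∷ a ∷ c ∷ w) ≡ avoids (c ∷ w) ∧ omits a w
  avoids-< {a} {c} w a<c
    rewrite ≡ᵇ-refl a | <⇒<ᵇ≡true a<c | containsVinc-≢ w (<⇒≢ a<c) =
      avoid-∨ (any (a ≡ᵇ_) w) (containsVinc (c ∷ w))
    where
    avoid-∨ : ∀ x y → (if x ∨ y then false else true) ≡ (if y then false else true) ∧ not x
    avoid-∨ true  true  = refl
    avoid-∨ true  false = refl
    avoid-∨ false y     = sym (∧-identityʳ _)

  count-second-letter : ∀ k a b N →
    count (λ w → avoids (a ∷ b ∷ w)) k N ≡ (if b ≡ᵇ a then P k a N else H k b N)
  count-second-letter k a b N with b ≟ a
  ... | yes refl rewrite ≡ᵇ-refl b = refl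
  ... | no b≢a rewrite ≢⇒≡ᵇ≡false b≢a =
    count-cong k N (λ w → avoids-cong (containsVinc-≢ w (b≢a ∘ sym)))

  punchIn-pred : ∀ {a c} → a < c → punchIn a (c ∸ 1) ≡ c
  punchIn-pred {c = suc c} (s≤s a≤c) rewrite ≤⇒>ᵇ≡false a≤c = refl

  count-third-letter : ∀ {k a} c N → a ≤ k →
    count (λ w → avoids (a ∷ a ∷ c ∷ w)) (suc k) N
      ≡ (if c <ᵇ a then H (suc k) c N else if c ≡ᵇ a then P (suc k) a N else H k (c ∸ 1) N)
  count-third-letter {k} {a} c N a≤k with <-cmp c a
  ... | tri< c<a _ _ rewrite <⇒<ᵇ≡true c<a =
    count-cong (suc k) N (λ w →
      avoids-cong (trans (containsVinc-≮ w (<⇒≯ c<a)) (containsVinc-≢ w (<⇒≢ c<a ∘ sym))))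
  ... | tri≈ _ refl _ rewrite ≤⇒>ᵇ≡false (≤-refl {c}) | ≡ᵇ-refl c = refl
  ... | tri> _ c≢a a<c rewrite ≤⇒>ᵇ≡false (<⇒≤ a<c) | ≢⇒≡ᵇ≡false c≢a =
    trans (count-cong (suc k) N (λ w → avoids-< w a<c))
      (trans (count-omits a≤k N (λ w → avoids (c ∷ w)))
        (count-cong k N (λ w →
          trans (cong (λ x → avoids (x ∷ map (punchIn a) w)) (sym (punchIn-pred a<c)))
                (avoids-map-punchIn a (c ∸ 1 ∷ w)))))

  if-same : ∀ {A : Set} b (x : A) → (if b then x else x) ≡ x
  if-same true  x = refl
  if-same false x = refl

  sumBelow sumAbove : ℕ → ℕ → (ℕ → ℕ) → ℕ
  sumBelow k a F = sumℕ k (λ c → if c <ᵇ a then F c else 0)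
  sumAbove k a F = sumℕ k (λ c → if a <ᵇ c then F c else 0)

  if-trichotomy : ∀ c a (x y z : ℕ) →
    (if c <ᵇ a then x else if c ≡ᵇ a then y else z)
      ≡ (if c <ᵇ a then x else 0) + (if c ≡ᵇ a then y else 0) + (if a <ᵇ c then z else 0)
  if-trichotomy c a x y z with <-cmp c a
  ... | tri< c<a c≢a _ rewrite <⇒<ᵇ≡true c<a | ≢⇒≡ᵇ≡false c≢a | ≤⇒>ᵇ≡false (<⇒≤ c<a) =
    sym (trans (+-identityʳ _) (+-identityʳ x))
  ... | tri≈ _ refl _ rewrite ≤⇒>ᵇ≡false (≤-refl {c}) | ≡ᵇ-refl c = sym (+-identityʳ y)
  ... | tri> _ c≢a a<c rewrite ≤⇒>ᵇ≡false (<⇒≤ a<c) | ≢⇒≡ᵇ≡false c≢a | <⇒<ᵇ≡true a<c = refl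

  sumℕ-trichotomy : ∀ {k a} (F G K : ℕ → ℕ) → a < k →
    sumℕ k (λ c → if c <ᵇ a then F c else if c ≡ᵇ a then G c else K c)
      ≡ sumBelow k a F + G a + sumAbove k a K
  sumℕ-trichotomy {k} {a} F G K a<k =
    trans (sumℕ-cong k (λ c _ → if-trichotomy c a (F c) (G c) (K c)))
      (trans (sumℕ-distrib-+ k _ _)
        (cong (_+ sumAbove k a K)
          (trans (sumℕ-distrib-+ k _ _) (cong (sumBelow k a F +_) (sumℕ-delta G a<k)))))

  sumℕ-split : ∀ {k a} (F : ℕ → ℕ) → a < k → sumℕ k F ≡ sumBelow k a F + F a + sumAbove k a F
  sumℕ-split {k} {a} F a<k =
    trans (sumℕ-cong k (λ c _ → sym (trans (cong (λ x → if c <ᵇ a then F c else x) (if-same (c ≡ᵇ a) (F c)))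
                                          (if-same (c <ᵇ a) (F c)))))
          (sumℕ-trichotomy F F F a<k)

  sumℕ-replace : ∀ {k a} (F : ℕ → ℕ) x → a < k →
    sumℕ k (λ b → if b ≡ᵇ a then x else F b) + F a ≡ sumℕ k F + x
  sumℕ-replace {k} {a} F x a<k =
    trans (cong (sumℕ k (λ b → if b ≡ᵇ a then x else F b) +_) (sym (sumℕ-delta F a<k)))
     (trans (sym (sumℕ-distrib-+ k _ _))
      (trans (sumℕ-cong k (λ b _ → swap-at b))
       (trans (sumℕ-distrib-+ k _ _) (cong (sumℕ k F +_) (sumℕ-delta (λ _ → x) a<k)))))
    where
    swap-at : ∀ b → (if b ≡ᵇ a then x else F b) + (if b ≡ᵇ a then F b else 0)
                  ≡ F b + (if b ≡ᵇ a then x else 0)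
    swap-at b with b ≡ᵇ a
    ... | true  = +-comm x (F b)
    ... | false = refl

  sumAbove-suc : ∀ {k a} (F : ℕ → ℕ) → suc a < k → sumAbove k a F ≡ F (suc a) + sumAbove k (suc a) F
  sumAbove-suc {k} {a} F 1+a<k =
    trans (sumℕ-cong k (λ c _ → split-at c))
      (trans (sumℕ-distrib-+ k _ _) (cong (_+ sumAbove k (suc a) F) (sumℕ-delta F 1+a<k)))
    where
    split-at : ∀ c → (if a <ᵇ c then F c else 0)
                   ≡ (if c ≡ᵇ suc a then F c else 0) + (if suc a <ᵇ c then F c else 0)
    split-at c with <-cmp c (suc a)
    ... | tri< (s≤s c≤a) c≢1+a _ rewrite ≤⇒>ᵇ≡false c≤a | ≢⇒≡ᵇ≡false c≢1+a | ≤⇒>ᵇ≡false (m≤n⇒m≤1+n c≤a) = refl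
    ... | tri≈ _ refl _ rewrite <⇒<ᵇ≡true (≤-refl {c}) | ≡ᵇ-refl c | ≤⇒>ᵇ≡false (≤-refl {c}) = sym (+-identityʳ _)
    ... | tri> _ c≢1+a 1+a<c rewrite <⇒<ᵇ≡true (<-trans (n<1+n a) 1+a<c) | ≢⇒≡ᵇ≡false c≢1+a | <⇒<ᵇ≡true 1+a<c = refl

  H-suc : ∀ {k a} N → a < k → H k a (suc N) + H k a N ≡ count avoids k (suc N) + P k a N
  H-suc {k} {a} N a<k =
    trans (cong (_+ H k a N) (sumℕ-cong k (λ b _ → count-second-letter k a b N)))
          (sumℕ-replace (λ b → H k b N) (P k a N) a<k)

  P-suc : ∀ {k a} N → a ≤ k →
    P (suc k) a (suc N)
      ≡ sumBelow (suc k) a (λ c → H (suc k) c N) + P (suc k) a N + sumAbove (suc k) a (λ c → H k (c ∸ 1) N)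
  P-suc {k} {a} N a≤k =
    trans (sumℕ-cong (suc k) (λ c _ → count-third-letter c N a≤k))
          (sumℕ-trichotomy (λ c → H (suc k) c N) (λ _ → P (suc k) a N) (λ c → H k (c ∸ 1) N) (s≤s a≤k))

  -- Two instances of H-suc and one of P-suc, with P eliminated.
  H-suc-suc : ∀ {k a} N → a ≤ k →
    H (suc k) a (suc (suc N)) + sumAbove (suc k) a (λ c → H (suc k) c N)
      ≡ count avoids (suc k) (suc (suc N)) + sumAbove (suc k) a (λ c → H k (c ∸ 1) N)
  H-suc-suc {k} {a} N a≤k = +-cancelʳ-≡ (H₁ + H₀) _ _ (begin
      (H₂ + U) + (H₁ + H₀)              ≡⟨ regroup H₂ U H₁ H₀ ⟩
      (H₂ + H₁) + U + H₀                ≡⟨ cong (λ x → x + U + H₀) (H-suc (suc N) a<1+k) ⟩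
      (W₂ + P₁) + U + H₀                ≡⟨ cong (λ x → W₂ + x + U + H₀) (P-suc N a≤k) ⟩
      (W₂ + (L + P₀ + U′)) + U + H₀     ≡⟨ regroup′ W₂ L P₀ U′ U H₀ ⟩
      (W₂ + U′) + (L + H₀ + U) + P₀     ≡⟨ cong (λ x → W₂ + U′ + x + P₀) (sym (sumℕ-split (λ c → H (suc k) c N) a<1+k)) ⟩
      (W₂ + U′) + W₁ + P₀               ≡⟨ +-assoc (W₂ + U′) W₁ P₀ ⟩
      (W₂ + U′) + (W₁ + P₀)             ≡⟨ cong (W₂ + U′ +_) (sym (H-suc N a<1+k)) ⟩
      (W₂ + U′) + (H₁ + H₀)             ∎)
    where
    open ≡-Reasoning
    a<1+k = s≤s a≤k
    H₀ H₁ H₂ P₀ P₁ W₁ W₂ L U U′ : ℕ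
    H₀ = H (suc k) a N
    H₁ = H (suc k) a (suc N)
    H₂ = H (suc k) a (suc (suc N))
    P₀ = P (suc k) a N
    P₁ = P (suc k) a (suc N)
    W₁ = count avoids (suc k) (suc N)
    W₂ = count avoids (suc k) (suc (suc N))
    L  = sumBelow (suc k) a (λ c → H (suc k) c N)
    U  = sumAbove (suc k) a (λ c → H (suc k) c N)
    U′ = sumAbove (suc k) a (λ c → H k (c ∸ 1) N)
    regroup : ∀ h₂ u h₁ h₀ → (h₂ + u) + (h₁ + h₀) ≡ (h₂ + h₁) + u + h₀
    regroup = solve-∀
    regroup′ : ∀ w l p u′ u h → (w + (l + p + u′)) + u + h ≡ (w + u′) + (l + h + u) + p
    regroup′ = solve-∀

  -- Subtracting H-suc-suc at a + 1 from H-suc-suc at a.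
  H-recurrence : ∀ {k a} N → suc a ≤ k →
    H (suc k) a (suc (suc N)) + H (suc k) (suc a) N ≡ H (suc k) (suc a) (suc (suc N)) + H k a N
  H-recurrence {k} {a} N 1+a≤k = +-cancelʳ-≡ (sumAbove (suc k) (suc a) Hᵏ⁺¹) _ _ (begin
      Hₐ + Hᵏ⁺¹ (suc a) + U          ≡⟨ +-assoc Hₐ _ _ ⟩
      Hₐ + (Hᵏ⁺¹ (suc a) + U)        ≡⟨ cong (Hₐ +_) (sym (sumAbove-suc Hᵏ⁺¹ 2+a≤1+k)) ⟩
      Hₐ + sumAbove (suc k) a Hᵏ⁺¹   ≡⟨ H-suc-suc N (≤-trans (n≤1+n a) 1+a≤k) ⟩
      W₂ + sumAbove (suc k) a Hᵏ     ≡⟨ cong (W₂ +_) (sumAbove-suc Hᵏ 2+a≤1+k) ⟩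
      W₂ + (H k a N + U′)            ≡⟨ x∙yz≈xz∙y W₂ (H k a N) U′ ⟩
      W₂ + U′ + H k a N              ≡⟨ cong (_+ H k a N) (sym (H-suc-suc N 1+a≤k)) ⟩
      Hₐ₊₁ + U + H k a N             ≡⟨ xy∙z≈xz∙y Hₐ₊₁ U (H k a N) ⟩
      Hₐ₊₁ + H k a N + U             ∎)
    where
    open ≡-Reasoning
    2+a≤1+k = s≤s 1+a≤k
    Hᵏ⁺¹ Hᵏ : ℕ → ℕ
    Hᵏ⁺¹ c = H (suc k) c N
    Hᵏ   c = H k (c ∸ 1) N
    Hₐ Hₐ₊₁ W₂ U U′ : ℕ
    Hₐ   = H (suc k) a (suc (suc N))
    Hₐ₊₁ = H (suc k) (suc a) (suc (suc N))
    W₂   = count avoids (suc k) (suc (suc N))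
    U    = sumAbove (suc k) (suc a) Hᵏ⁺¹
    U′   = sumAbove (suc k) (suc a) Hᵏ

  -- No letter exceeds m, so an initial m m never starts an occurrence.
  P-top : ∀ m N → P (suc m) m N ≡ H (suc m) m N
  P-top m zero    = refl
  P-top m (suc N) =
    sumℕ-cong (suc m) (λ c c≤m →
      trans (count-third-letter {m} c N ≤-refl) (trans (third≡second c c≤m) (sym (count-second-letter (suc m) m c N))))
    where
    third≡second : ∀ c → c < suc m →
      (if c <ᵇ m then H (suc m) c N else if c ≡ᵇ m then P (suc m) m N else H m (c ∸ 1) N)
        ≡ (if c ≡ᵇ m then P (suc m) m N else H (suc m) c N)
    third≡second c (s≤s c≤m) with <-cmp c m
    ... | tri< c<m c≢m _ rewrite <⇒<ᵇ≡true c<m | ≢⇒≡ᵇ≡false c≢m = refl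
    ... | tri≈ _ refl _  rewrite ≤⇒>ᵇ≡false (≤-refl {c}) | ≡ᵇ-refl c = refl
    ... | tri> _ _ m<c   = contradiction c≤m (<⇒≱ m<c)

  H-top : ∀ m N → H (suc m) m N ≡ count avoids (suc m) N
  H-top m zero    = refl
  H-top m (suc N) = sumℕ-cong (suc m) (λ b _ → trans (count-second-letter (suc m) m b N) (second-letter b))
    where
    second-letter : ∀ b → (if b ≡ᵇ m then P (suc m) m N else H (suc m) b N) ≡ H (suc m) b N
    second-letter b with b ≟ m
    ... | yes refl rewrite ≡ᵇ-refl b = P-top b N
    ... | no b≢m   rewrite ≢⇒≡ᵇ≡false b≢m = refl

module Series where

  open import Data.Integer using (ℤ; +_; -_; _+_; _*_; -1ℤ)
  open import Data.Integer.Properties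
  open import Algebra.Properties.CommutativeSemigroup +-commutativeSemigroup using (interchange)
  open import Algebra.Properties.CommutativeSemigroup *-commutativeSemigroup using (x∙yz≈y∙xz)
  open import Algebra.Properties.CommutativeSemigroup +-commutativeSemigroup using (xy∙z≈xz∙y)
  open import Data.Integer.Tactic.RingSolver using (solve-∀)
  open import Data.List using (foldr; applyUpTo)
  open import Data.List.Properties using (map-applyUpTo)
  open import Data.Nat using (ℕ; zero; suc; _∸_; _<_; z≤n; s≤s) renaming (_+_ to _+ℕ_)
  open import Function using (_∘_; id)
  open import Relation.Binary.Bundles using (Setoid)
  open import Relation.Binary.PropositionalEquality

  infix 4 _≈_
  record _≈_ (f g : PS) : Set where
    constructor coefficientwise
    field coeff : ∀ n → f n ≡ g n
  open _≈_ public

  ≈-setoid : Setoid _ _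
  ≈-setoid = record
    { Carrier       = PS
    ; _≈_           = _≈_
    ; isEquivalence = record
      { refl  = coefficientwise (λ _ → refl)
      ; sym   = λ f≈g → coefficientwise (sym ∘ coeff f≈g)
      ; trans = λ f≈g g≈h → coefficientwise (λ n → trans (coeff f≈g n) (coeff g≈h n))
      }
    }

  open Setoid ≈-setoid public using () renaming (refl to ≈-refl; sym to ≈-sym; trans to ≈-trans)

  sumℤ : ℕ → (ℕ → ℤ) → ℤ
  sumℤ m F = foldr _+_ (+ 0) (applyUpTo F m)

  sumℤ-cong : ∀ m {F G : ℕ → ℤ} → (∀ i → F i ≡ G i) → sumℤ m F ≡ sumℤ m G
  sumℤ-cong zero    F≗G = refl
  sumℤ-cong (suc m) F≗G = cong₂ _+_ (F≗G 0) (sumℤ-cong m (F≗G ∘ suc))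

  sumℤ-distrib-+ : ∀ m (F G : ℕ → ℤ) → sumℤ m (λ i → F i + G i) ≡ sumℤ m F + sumℤ m G
  sumℤ-distrib-+ zero    F G = refl
  sumℤ-distrib-+ (suc m) F G =
    trans (cong (λ x → F 0 + G 0 + x) (sumℤ-distrib-+ m (F ∘ suc) (G ∘ suc)))
          (interchange (F 0) (G 0) (sumℤ m (F ∘ suc)) (sumℤ m (G ∘ suc)))

  sumℤ-*ˡ : ∀ m c (F : ℕ → ℤ) → sumℤ m (λ i → c * F i) ≡ c * sumℤ m F
  sumℤ-*ˡ zero    c F = sym (*-zeroʳ c)
  sumℤ-*ˡ (suc m) c F = trans (cong (λ x → c * F 0 + x) (sumℤ-*ˡ m c (F ∘ suc))) (sym (*-distribˡ-+ c (F 0) _))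

  sumℤ-zero : ∀ m → sumℤ m (λ _ → + 0) ≡ + 0
  sumℤ-zero zero    = refl
  sumℤ-zero (suc m) = trans (+-identityˡ _) (sumℤ-zero m)

  ⊛-unfold : ∀ f g n → (f ⊛ g) n ≡ sumℤ (suc n) (λ i → f i * g (n ∸ i))
  ⊛-unfold f g n = cong (foldr _+_ (+ 0)) (map-applyUpTo id (λ i → f i * g (n ∸ i)) (suc n))

  tailₚ : PS → PS
  tailₚ f i = f (suc i)

  ⊛-suc : ∀ f g n → (f ⊛ g) (suc n) ≡ f 0 * g (suc n) + (tailₚ f ⊛ g) n
  ⊛-suc f g n = trans (⊛-unfold f g (suc n)) (cong (λ x → f 0 * g (suc n) + x) (sym (⊛-unfold (tailₚ f) g n)))

  ⊛-cong : ∀ {f f′ g g′} → f ≈ f′ → g ≈ g′ → f ⊛ g ≈ f′ ⊛ g′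
  ⊛-cong {f} {f′} {g} {g′} f≈f′ g≈g′ = coefficientwise λ n →
    trans (⊛-unfold f g n)
      (trans (sumℤ-cong (suc n) (λ i → cong₂ _*_ (coeff f≈f′ i) (coeff g≈g′ (n ∸ i))))
             (sym (⊛-unfold f′ g′ n)))

  ⊛-congˡ : ∀ {f f′} g → f ≈ f′ → f ⊛ g ≈ f′ ⊛ g
  ⊛-congˡ g f≈f′ = ⊛-cong f≈f′ (≈-refl {g})

  ⊛-congʳ : ∀ f {g g′} → g ≈ g′ → f ⊛ g ≈ f ⊛ g′
  ⊛-congʳ f g≈g′ = ⊛-cong (≈-refl {f}) g≈g′

  ⊕-cong : ∀ {f f′ g g′} → f ≈ f′ → g ≈ g′ → f ⊕ g ≈ f′ ⊕ g′
  ⊕-cong f≈f′ g≈g′ = coefficientwise λ n → cong₂ _+_ (coeff f≈f′ n) (coeff g≈g′ n)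

  ⊕-congʳ : ∀ f {g g′} → g ≈ g′ → f ⊕ g ≈ f ⊕ g′
  ⊕-congʳ f g≈g′ = ⊕-cong (≈-refl {f}) g≈g′

  ⊛-distribʳ-⊕ : ∀ f g h → (f ⊕ g) ⊛ h ≈ f ⊛ h ⊕ g ⊛ h
  ⊛-distribʳ-⊕ f g h = coefficientwise λ n →
    trans (⊛-unfold (f ⊕ g) h n)
     (trans (sumℤ-cong (suc n) (λ i → *-distribʳ-+ (h (n ∸ i)) (f i) (g i)))
      (trans (sumℤ-distrib-+ (suc n) (λ i → f i * h (n ∸ i)) (λ i → g i * h (n ∸ i))) (sym (cong₂ _+_ (⊛-unfold f h n) (⊛-unfold g h n)))))

  ⊛-distribˡ-⊕ : ∀ h f g → h ⊛ (f ⊕ g) ≈ h ⊛ f ⊕ h ⊛ g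
  ⊛-distribˡ-⊕ h f g = coefficientwise λ n →
    trans (⊛-unfold h (f ⊕ g) n)
     (trans (sumℤ-cong (suc n) (λ i → *-distribˡ-+ (h i) (f (n ∸ i)) (g (n ∸ i))))
      (trans (sumℤ-distrib-+ (suc n) (λ i → h i * f (n ∸ i)) (λ i → h i * g (n ∸ i))) (sym (cong₂ _+_ (⊛-unfold h f n) (⊛-unfold h g n)))))

  ·-⊛ : ∀ c f g → (c · f) ⊛ g ≈ c · (f ⊛ g)
  ·-⊛ c f g = coefficientwise λ n →
    trans (⊛-unfold (c · f) g n)
     (trans (sumℤ-cong (suc n) (λ i → *-assoc c (f i) (g (n ∸ i))))
      (trans (sumℤ-*ˡ (suc n) c (λ i → f i * g (n ∸ i))) (cong (c *_) (sym (⊛-unfold f g n)))))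

  ⊛-· : ∀ c f g → f ⊛ (c · g) ≈ c · (f ⊛ g)
  ⊛-· c f g = coefficientwise λ n →
    trans (⊛-unfold f (c · g) n)
     (trans (sumℤ-cong (suc n) (λ i → x∙yz≈y∙xz (f i) c (g (n ∸ i))))
      (trans (sumℤ-*ˡ (suc n) c (λ i → f i * g (n ∸ i))) (cong (c *_) (sym (⊛-unfold f g n)))))

  ⊛-zeroˡ : ∀ h → 𝟘 ⊛ h ≈ 𝟘
  ⊛-zeroˡ h = coefficientwise λ n → trans (⊛-unfold 𝟘 h n) (sumℤ-zero (suc n))

  ⊛-zeroʳ : ∀ h → h ⊛ 𝟘 ≈ 𝟘
  ⊛-zeroʳ h = coefficientwise λ n →
    trans (⊛-unfold h 𝟘 n) (trans (sumℤ-cong (suc n) (λ i → *-zeroʳ (h i))) (sumℤ-zero (suc n)))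

  ⊛-identityˡ : ∀ f → 𝟙 ⊛ f ≈ f
  ⊛-identityˡ f = coefficientwise λ n →
    trans (⊛-unfold 𝟙 f n)
      (trans (cong (λ x → + 1 * f n + x) (sumℤ-zero n)) (trans (+-identityʳ _) (*-identityˡ (f n))))

  tail-⊛ : ∀ f g → tailₚ (f ⊛ g) ≈ f 0 · tailₚ g ⊕ tailₚ f ⊛ g
  tail-⊛ f g = coefficientwise (⊛-suc f g)

  ⊛-assoc : ∀ f g h → (f ⊛ g) ⊛ h ≈ f ⊛ (g ⊛ h)
  ⊛-assoc f g h = coefficientwise (coeff-assoc f)
    where
    open ≡-Reasoning
    coeff-assoc : ∀ f n → ((f ⊛ g) ⊛ h) n ≡ (f ⊛ (g ⊛ h)) n
    coeff-assoc f zero    = lemma (f 0) (g 0) (h 0)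
      where
      lemma : ∀ a b c → (a * b + + 0) * c + + 0 ≡ a * (b * c + + 0) + + 0
      lemma = solve-∀
    coeff-assoc f (suc n) = begin
        ((f ⊛ g) ⊛ h) (suc n)
      ≡⟨ ⊛-suc (f ⊛ g) h n ⟩
        (f ⊛ g) 0 * h (suc n) + (tailₚ (f ⊛ g) ⊛ h) n
      ≡⟨ cong (λ x → (f ⊛ g) 0 * h (suc n) + x) tail-step ⟩
        (f ⊛ g) 0 * h (suc n) + (f 0 * (tailₚ g ⊛ h) n + (tailₚ f ⊛ (g ⊛ h)) n)
      ≡⟨ regroup (f 0) (g 0) (h (suc n)) ((tailₚ g ⊛ h) n) ((tailₚ f ⊛ (g ⊛ h)) n) ⟩
        f 0 * (g 0 * h (suc n) + (tailₚ g ⊛ h) n) + (tailₚ f ⊛ (g ⊛ h)) n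
      ≡⟨ cong (λ x → f 0 * x + (tailₚ f ⊛ (g ⊛ h)) n) (sym (⊛-suc g h n)) ⟩
        f 0 * (g ⊛ h) (suc n) + (tailₚ f ⊛ (g ⊛ h)) n
      ≡⟨ sym (⊛-suc f (g ⊛ h) n) ⟩
        (f ⊛ (g ⊛ h)) (suc n)
      ∎
      where
      regroup : ∀ a b c d e → (a * b + + 0) * c + (a * d + e) ≡ a * (b * c + d) + e
      regroup = solve-∀
      tail-step : (tailₚ (f ⊛ g) ⊛ h) n ≡ f 0 * (tailₚ g ⊛ h) n + (tailₚ f ⊛ (g ⊛ h)) n
      tail-step =
        trans (coeff (≈-trans (⊛-congˡ h (tail-⊛ f g))
                     (≈-trans (⊛-distribʳ-⊕ (f 0 · tailₚ g) (tailₚ f ⊛ g) h)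
                              (⊕-cong (·-⊛ (f 0) (tailₚ g) h) (≈-refl {(tailₚ f ⊛ g) ⊛ h})))) n)
              (cong (λ x → f 0 * (tailₚ g ⊛ h) n + x) (coeff-assoc (tailₚ f) n))

  ·-distribʳ : ∀ a b f → (a + b) · f ≈ a · f ⊕ b · f
  ·-distribʳ a b f = coefficientwise λ n → *-distribʳ-+ (f n) a b

  ·-zeroˡ : ∀ f → + 0 · f ≈ 𝟘
  ·-zeroˡ f = coefficientwise λ _ → refl

  ·-identityˡ : ∀ f → + 1 · f ≈ f
  ·-identityˡ f = coefficientwise λ n → *-identityˡ (f n)

  ⊝-⊛ : ∀ f g → ⊝ f ⊛ g ≈ ⊝ (f ⊛ g)
  ⊝-⊛ f g = ≈-trans (⊛-congˡ g (coefficientwise λ n → sym (-1*i≡-i (f n))))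
           (≈-trans (·-⊛ -1ℤ f g) (coefficientwise λ n → -1*i≡-i ((f ⊛ g) n)))

  raise : ℕ → PS → PS
  raise zero    f         = f
  raise (suc m) f zero    = + 0
  raise (suc m) f (suc n) = raise m f n

  X^-⊛ : ∀ m f → X^ m ⊛ f ≈ raise m f
  X^-⊛ m f = coefficientwise (coeff-X^-⊛ m f)
    where
    coeff-X^-⊛ : ∀ m f n → (X^ m ⊛ f) n ≡ raise m f n
    coeff-X^-⊛ zero    f n       = coeff (≈-trans (⊛-congˡ f X^0≈𝟙) (⊛-identityˡ f)) n
      where
      X^0≈𝟙 : X^ 0 ≈ 𝟙
      X^0≈𝟙 = coefficientwise λ { zero → refl ; (suc _) → refl }
    coeff-X^-⊛ (suc m) f zero    = refl
    coeff-X^-⊛ (suc m) f (suc n) = trans (⊛-suc (X^ (suc m)) f n) (trans (+-identityˡ _) (coeff-X^-⊛ m f n))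

  raise-suc : ∀ m f n → raise m f (suc n) ≡ f 0 * X^ m (suc n) + raise m (tailₚ f) n
  raise-suc zero          f n       = trans (sym (+-identityˡ _)) (cong (_+ f (suc n)) (sym (*-zeroʳ (f 0))))
  raise-suc (suc zero)    f zero    = trans (sym (*-identityʳ (f 0))) (sym (+-identityʳ _))
  raise-suc (suc (suc m)) f zero    = sym (trans (+-identityʳ _) (*-zeroʳ (f 0)))
  raise-suc (suc m)       f (suc n) = raise-suc m f n

  ⊛-X^ : ∀ m f → f ⊛ X^ m ≈ raise m f
  ⊛-X^ m f = coefficientwise (coeff-⊛-X^ m f)
    where
    coeff-⊛-X^ : ∀ m f n → (f ⊛ X^ m) n ≡ raise m f n
    coeff-⊛-X^ zero    f zero    = trans (+-identityʳ _) (*-identityʳ (f 0))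
    coeff-⊛-X^ (suc m) f zero    = trans (+-identityʳ _) (*-zeroʳ (f 0))
    coeff-⊛-X^ m       f (suc n) =
      trans (⊛-suc f (X^ m) n)
        (trans (cong (λ x → f 0 * X^ m (suc n) + x) (coeff-⊛-X^ m (tailₚ f) n)) (sym (raise-suc m f n)))

  raise-X^ : ∀ m q → raise m (X^ q) ≈ X^ (m +ℕ q)
  raise-X^ m q = coefficientwise (coeff-raise-X^ m)
    where
    coeff-raise-X^ : ∀ m n → raise m (X^ q) n ≡ X^ (m +ℕ q) n
    coeff-raise-X^ zero    n       = refl
    coeff-raise-X^ (suc m) zero    = refl
    coeff-raise-X^ (suc m) (suc n) = coeff-raise-X^ m n

  1-x²-⊛ : ∀ f → 1-x² ⊛ f ≈ f ⊕ ⊝ (X^ 2 ⊛ f)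
  1-x²-⊛ f = ≈-trans (⊛-distribʳ-⊕ 𝟙 (⊝ (X^ 2)) f) (⊕-cong (⊛-identityˡ f) (⊝-⊛ (X^ 2) f))

  ⊕-identityʳ : ∀ f → f ⊕ 𝟘 ≈ f
  ⊕-identityʳ f = coefficientwise λ n → +-identityʳ (f n)

  ⊝-cong : ∀ {f g} → f ≈ g → ⊝ f ≈ ⊝ g
  ⊝-cong f≈g = coefficientwise λ n → cong -_ (coeff f≈g n)

  ⊕-transpose : ∀ {a b} c d → a ⊕ b ≈ c ⊕ d → a ≈ c ⊕ ⊝ b ⊕ d
  ⊕-transpose {a} {b} c d a+b≈c+d = coefficientwise λ n → begin
      a n                    ≡⟨ add-sub (a n) (b n) ⟩
      a n + b n + - b n      ≡⟨ cong (_+ - b n) (coeff a+b≈c+d n) ⟩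
      c n + d n + - b n      ≡⟨ xy∙z≈xz∙y (c n) (d n) (- b n) ⟩
      c n + - b n + d n      ∎
    where
    open ≡-Reasoning
    add-sub : ∀ x y → x ≡ x + y + - y
    add-sub = solve-∀

  sumℤ-triangle : ∀ m (T : ℕ → ℕ → ℤ) →
    sumℤ m (λ j → sumℤ (m ∸ j) (λ t → T (j +ℕ t) j)) ≡ sumℤ m (λ i → sumℤ (suc i) (T i))
  sumℤ-triangle zero    T = refl
  sumℤ-triangle (suc m) T = begin
      first-column + sumℤ m (λ j → sumℤ (m ∸ j) (λ t → T (suc j +ℕ t) (suc j)))
    ≡⟨ cong (λ x → first-column + x) (sumℤ-triangle m (λ i j → T (suc i) (suc j))) ⟩
      T 0 0 + sumℤ m (λ i → T (suc i) 0) + sumℤ m (λ i → sumℤ (suc i) (T (suc i) ∘ suc))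
    ≡⟨ regroup (T 0 0) _ _ ⟩
      T 0 0 + + 0 + (sumℤ m (λ i → T (suc i) 0) + sumℤ m (λ i → sumℤ (suc i) (T (suc i) ∘ suc)))
    ≡⟨ cong (λ x → T 0 0 + + 0 + x) (sym (sumℤ-distrib-+ m (λ i → T (suc i) 0) (λ i → sumℤ (suc i) (T (suc i) ∘ suc)))) ⟩
      T 0 0 + + 0 + sumℤ m (λ i → sumℤ (suc (suc i)) (T (suc i)))
    ∎
    where
    open ≡-Reasoning
    first-column = sumℤ (suc m) (λ t → T t 0)
    regroup : ∀ x y z → x + y + z ≡ x + + 0 + (y + z)
    regroup = solve-∀

  sumₚ : ℕ → (ℕ → PS) → PS
  sumₚ zero    G = 𝟘
  sumₚ (suc m) G = G 0 ⊕ sumₚ m (G ∘ suc)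

  sumₚ-coeff : ∀ m G n → sumₚ m G n ≡ sumℤ m (λ i → G i n)
  sumₚ-coeff zero    G n = refl
  sumₚ-coeff (suc m) G n = cong (λ x → G 0 n + x) (sumₚ-coeff m (G ∘ suc) n)

  sumₚ-cong : ∀ m {G G′ : ℕ → PS} → (∀ i → i < m → G i ≈ G′ i) → sumₚ m G ≈ sumₚ m G′
  sumₚ-cong zero    G≈G′ = ≈-refl
  sumₚ-cong (suc m) G≈G′ = ⊕-cong (G≈G′ 0 (s≤s z≤n)) (sumₚ-cong m (λ i i<m → G≈G′ (suc i) (s≤s i<m)))

  sumₚ-⊛ : ∀ m G h → sumₚ m G ⊛ h ≈ sumₚ m (λ i → G i ⊛ h)
  sumₚ-⊛ zero    G h = ⊛-zeroˡ h
  sumₚ-⊛ (suc m) G h = ≈-trans (⊛-distribʳ-⊕ (G 0) (sumₚ m (G ∘ suc)) h) (⊕-congʳ (G 0 ⊛ h) (sumₚ-⊛ m (G ∘ suc) h))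

  ⊛-sumₚ : ∀ m h G → h ⊛ sumₚ m G ≈ sumₚ m (λ i → h ⊛ G i)
  ⊛-sumₚ zero    h G = ⊛-zeroʳ h
  ⊛-sumₚ (suc m) h G = ≈-trans (⊛-distribˡ-⊕ h (G 0) (sumₚ m (G ∘ suc))) (⊕-congʳ (h ⊛ G 0) (⊛-sumₚ m h (G ∘ suc)))

  sumₚ-distrib-⊕ : ∀ m G G′ → sumₚ m (λ i → G i ⊕ G′ i) ≈ sumₚ m G ⊕ sumₚ m G′
  sumₚ-distrib-⊕ zero    G G′ = coefficientwise λ _ → refl
  sumₚ-distrib-⊕ (suc m) G G′ = coefficientwise λ n →
    trans (cong (λ x → G 0 n + G′ 0 n + x) (coeff (sumₚ-distrib-⊕ m (G ∘ suc) (G′ ∘ suc)) n))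
          (interchange (G 0 n) (G′ 0 n) (sumₚ m (G ∘ suc) n) (sumₚ m (G′ ∘ suc) n))

  sumₚ-snoc : ∀ m G → sumₚ (suc m) G ≈ sumₚ m G ⊕ G m
  sumₚ-snoc zero    G = coefficientwise λ n → +-comm (G 0 n) (+ 0)
  sumₚ-snoc (suc m) G = coefficientwise λ n →
    trans (cong (λ x → G 0 n + x) (coeff (sumₚ-snoc m (G ∘ suc)) n)) (sym (+-assoc (G 0 n) _ _))

  sumₚ-triangle : ∀ m (T : ℕ → ℕ → PS) →
    sumₚ m (λ j → sumₚ (m ∸ j) (λ t → T (j +ℕ t) j)) ≈ sumₚ m (λ i → sumₚ (suc i) (T i))
  sumₚ-triangle m T = coefficientwise λ n →
    trans (sumₚ-coeff m _ n)
     (trans (sumℤ-cong m (λ j → sumₚ-coeff (m ∸ j) (λ t → T (j +ℕ t) j) n))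
      (trans (sumℤ-triangle m (λ i j → T i j n))
       (sym (trans (sumₚ-coeff m _ n) (sumℤ-cong m (λ i → sumₚ-coeff (suc i) (T i) n))))))

  Σₚ-applyUpTo : ∀ (g : ℕ → ℕ) m (F : ℕ → PS) → Σₚ (applyUpTo g m) F ≈ sumₚ m (F ∘ g)
  Σₚ-applyUpTo g zero    F = ≈-refl
  Σₚ-applyUpTo g (suc m) F = ⊕-congʳ (F (g 0)) (Σₚ-applyUpTo (g ∘ suc) m F)

  Σₚ-range : ∀ j k (F : ℕ → PS) → Σₚ (range j k) F ≈ sumₚ (k ∸ j) (λ t → F (j +ℕ t))
  Σₚ-range j k F rewrite map-applyUpTo id (j +ℕ_) (k ∸ j) = Σₚ-applyUpTo (j +ℕ_) (k ∸ j) F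

open Words using (sumℕ; sumℕ-reverse; H; H-top; H-recurrence; a112-1≡count)
open Series

open import Data.Nat using (ℕ; zero; suc; _+_; _*_; _∸_; _<_; _≤_; s≤s)
open import Data.Nat.Properties using (m∸n≤m; m<n⇒m<1+n; n<1+n)
open import Data.Nat.Combinatorics using (_C_; k>n⇒nCk≡0; nCk+nC[k+1]≡[n+1]C[k+1])
open import Data.Nat.Tactic.RingSolver using (solve-∀)
open import Data.Integer as ℤ using (ℤ; +_)
import Data.Integer.Properties as ℤ
import Data.Integer.Tactic.RingSolver as ℤ-Solver
open import Function using (_∘_)
open import Relation.Binary.PropositionalEquality
import Relation.Binary.Reasoning.Setoid ≈-setoid as ≈-Reasoning

sumℤ-+ : ∀ m (F : ℕ → ℕ) → sumℤ m (λ i → + F i) ≡ + sumℕ m F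
sumℤ-+ zero    F = refl
sumℤ-+ (suc m) F = cong (λ x → + F 0 ℤ.+ x) (sumℤ-+ m (F ∘ suc))

m∸n≡suc[m∸[1+n]] : ∀ {m n} → n < m → m ∸ n ≡ suc (m ∸ suc n)
m∸n≡suc[m∸[1+n]] {suc m} {zero}  _         = refl
m∸n≡suc[m∸[1+n]] {suc m} {suc n} (s≤s n<m) = m∸n≡suc[m∸[1+n]] n<m

-- G i k = x H_k(k-1-i; x): the nonempty avoiders over [k] whose first letter is the (i+1)-st largest.
G : ℕ → ℕ → PS
G i k = raise 1 (λ N → + H k (k ∸ suc i) N)

W≈𝟙⊕sumG : ∀ k → W k ≈ 𝟙 ⊕ sumₚ k (λ i → G i k)
W≈𝟙⊕sumG k = coefficientwise coeff-W
  where
  open ≡-Reasoning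
  coeff-W : ∀ n → W k n ≡ (𝟙 ⊕ sumₚ k (λ i → G i k)) n
  coeff-W zero    = cong (λ x → + 1 ℤ.+ x) (sym (trans (sumₚ-coeff k (λ i → G i k) 0) (sumℤ-zero k)))
  coeff-W (suc N) = begin
      + a112-1 (suc N) k                    ≡⟨ cong +_ (a112-1≡count (suc N) k) ⟩
      + sumℕ k (λ b → H k b N)             ≡⟨ cong +_ (sym (sumℕ-reverse k (λ b → H k b N))) ⟩
      + sumℕ k (λ i → H k (k ∸ suc i) N)   ≡⟨ sym (sumℤ-+ k (λ i → H k (k ∸ suc i) N)) ⟩
      sumℤ k (λ i → G i k (suc N))          ≡⟨ sym (sumₚ-coeff k (λ i → G i k) (suc N)) ⟩
      sumₚ k (λ i → G i k) (suc N)          ≡⟨ sym (ℤ.+-identityˡ _) ⟩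
      (𝟙 ⊕ sumₚ k (λ i → G i k)) (suc N)    ∎

G-base : ∀ m → G 0 (suc m) ≈ X^ 1 ⊛ W (suc m)
G-base m = ≈-sym (≈-trans (X^-⊛ 1 (W (suc m))) (coefficientwise λ where
  zero    → refl
  (suc N) → cong +_ (trans (a112-1≡count N (suc m)) (sym (H-top m N)))))

G-recurrence : ∀ {i k} → suc i ≤ k → G (suc i) (suc k) ⊕ raise 2 (G i (suc k)) ≈ G i (suc k) ⊕ raise 2 (G i k)
G-recurrence {i} {k} 1+i≤k = coefficientwise coeff-recurrence
  where
  k∸i≡1+a : k ∸ i ≡ suc (k ∸ suc i)
  k∸i≡1+a = m∸n≡suc[m∸[1+n]] 1+i≤k
  H-recurrence′ : ∀ N → H (suc k) (k ∸ suc i) (suc (suc N)) + H (suc k) (k ∸ i) N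
                      ≡ H (suc k) (k ∸ i) (suc (suc N)) + H k (k ∸ suc i) N
  H-recurrence′ N rewrite k∸i≡1+a = H-recurrence N (subst (_≤ k) k∸i≡1+a (m∸n≤m k i))
  coeff-recurrence : ∀ n → (G (suc i) (suc k) ⊕ raise 2 (G i (suc k))) n ≡ (G i (suc k) ⊕ raise 2 (G i k)) n
  coeff-recurrence zero                = refl
  coeff-recurrence (suc zero)          = refl
  coeff-recurrence (suc (suc zero))    = refl
  coeff-recurrence (suc (suc (suc N))) = cong +_ (H-recurrence′ N)

G-step : ∀ {i k} → suc i ≤ k → G (suc i) (suc k) ≈ 1-x² ⊛ G i (suc k) ⊕ X^ 2 ⊛ G i k
G-step {i} {k} 1+i≤k = begin
    G (suc i) (suc k)
  ≈⟨ ⊕-transpose (G i (suc k)) (raise 2 (G i k)) (G-recurrence 1+i≤k) ⟩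
    G i (suc k) ⊕ ⊝ (raise 2 (G i (suc k))) ⊕ raise 2 (G i k)
  ≈⟨ ⊕-cong (⊕-congʳ (G i (suc k)) (⊝-cong (≈-sym (X^-⊛ 2 (G i (suc k)))))) (≈-sym (X^-⊛ 2 (G i k))) ⟩
    G i (suc k) ⊕ ⊝ (X^ 2 ⊛ G i (suc k)) ⊕ X^ 2 ⊛ G i k
  ≈⟨ ⊕-cong (≈-sym (1-x²-⊛ (G i (suc k)))) (≈-refl {X^ 2 ⊛ G i k}) ⟩
    1-x² ⊛ G i (suc k) ⊕ X^ 2 ⊛ G i k
  ∎
  where open ≈-Reasoning

summand : ℕ → ℤ → ℕ → ℕ → PS
summand k c p j = c · (1-x² ^ₚ p) ⊛ X^ (2 * j + 1) ⊛ W (k ∸ j)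

summand-+ : ∀ k a b p j → summand k (+ (a + b)) p j ≈ summand k (+ a) p j ⊕ summand k (+ b) p j
summand-+ k a b p j =
  ≈-trans (⊛-congˡ (W (k ∸ j)) (≈-trans (⊛-congˡ (X^ (2 * j + 1)) (·-distribʳ (+ a) (+ b) (1-x² ^ₚ p)))
                                       (⊛-distribʳ-⊕ (+ a · (1-x² ^ₚ p)) (+ b · (1-x² ^ₚ p)) (X^ (2 * j + 1)))))
          (⊛-distribʳ-⊕ (+ a · (1-x² ^ₚ p) ⊛ X^ (2 * j + 1)) (+ b · (1-x² ^ₚ p) ⊛ X^ (2 * j + 1)) (W (k ∸ j)))

summand-0 : ∀ k p j → summand k (+ 0) p j ≈ 𝟘
summand-0 k p j =
  ≈-trans (⊛-congˡ (W (k ∸ j)) (≈-trans (⊛-congˡ (X^ (2 * j + 1)) (·-zeroˡ (1-x² ^ₚ p))) (⊛-zeroˡ (X^ (2 * j + 1)))))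
          (⊛-zeroˡ (W (k ∸ j)))

1-x²-summand : ∀ k c p j → 1-x² ⊛ summand k c p j ≈ summand k c (suc p) j
1-x²-summand k c p j = begin
    1-x² ⊛ (c · Y ⊛ Xⱼ ⊛ Wⱼ)      ≈⟨ ≈-sym (⊛-assoc 1-x² (c · Y ⊛ Xⱼ) Wⱼ) ⟩
    1-x² ⊛ (c · Y ⊛ Xⱼ) ⊛ Wⱼ      ≈⟨ ⊛-congˡ Wⱼ (≈-sym (⊛-assoc 1-x² (c · Y) Xⱼ)) ⟩
    1-x² ⊛ (c · Y) ⊛ Xⱼ ⊛ Wⱼ      ≈⟨ ⊛-congˡ Wⱼ (⊛-congˡ Xⱼ (⊛-· c 1-x² Y)) ⟩
    c · (1-x² ⊛ Y) ⊛ Xⱼ ⊛ Wⱼ      ∎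
  where
  open ≈-Reasoning
  Y = 1-x² ^ₚ p
  Xⱼ = X^ (2 * j + 1)
  Wⱼ = W (k ∸ j)

X²-summand : ∀ k c p j → X^ 2 ⊛ summand k c p j ≈ summand (suc k) c p (suc j)
X²-summand k c p j = begin
    X^ 2 ⊛ (g ⊛ Xⱼ ⊛ Wⱼ)         ≈⟨ ≈-sym (⊛-assoc (X^ 2) (g ⊛ Xⱼ) Wⱼ) ⟩
    X^ 2 ⊛ (g ⊛ Xⱼ) ⊛ Wⱼ         ≈⟨ ⊛-congˡ Wⱼ x²-commutes ⟩
    g ⊛ X^ (2 * suc j + 1) ⊛ Wⱼ  ∎
  where
  open ≈-Reasoning
  g = c · (1-x² ^ₚ p)
  Xⱼ = X^ (2 * j + 1)
  Wⱼ = W (k ∸ j)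
  exponent : ∀ j → 2 + (2 * j + 1) ≡ 2 * suc j + 1
  exponent = solve-∀
  x²-commutes : X^ 2 ⊛ (g ⊛ Xⱼ) ≈ g ⊛ X^ (2 * suc j + 1)
  x²-commutes = begin
    X^ 2 ⊛ (g ⊛ Xⱼ)          ≈⟨ X^-⊛ 2 (g ⊛ Xⱼ) ⟩
    raise 2 (g ⊛ Xⱼ)         ≈⟨ ≈-sym (⊛-X^ 2 (g ⊛ Xⱼ)) ⟩
    g ⊛ Xⱼ ⊛ X^ 2            ≈⟨ ⊛-assoc g Xⱼ (X^ 2) ⟩
    g ⊛ (Xⱼ ⊛ X^ 2)          ≈⟨ ⊛-congʳ g (≈-trans (⊛-X^ 2 Xⱼ) (raise-X^ 2 (2 * j + 1))) ⟩
    g ⊛ X^ (2 + (2 * j + 1)) ≡⟨ cong (λ e → g ⊛ X^ e) (exponent j) ⟩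
    g ⊛ X^ (2 * suc j + 1)   ∎

binomialSum : ℕ → ℕ → PS
binomialSum i k = sumₚ (suc i) (λ j → summand k (+ (i C j)) (i ∸ j) j)

-- Pascal's rule C(i+1, j+1) = C(i, j) + C(i, j+1), applied termwise.
binomialSum-step : ∀ i k → binomialSum (suc i) (suc k) ≈ 1-x² ⊛ binomialSum i (suc k) ⊕ X^ 2 ⊛ binomialSum i k
binomialSum-step i k = begin
    binomialSum (suc i) (suc k)         ≈⟨ ⊕-congʳ A₀ pascal ⟩
    A₀ ⊕ (Xs ⊕ (Rs ⊕ 𝟘))               ≈⟨ coefficientwise (λ n → regroup (A₀ n) (Xs n) (Rs n)) ⟩
    A₀ ⊕ Rs ⊕ Xs                        ≈⟨ ⊕-cong (≈-sym 1-x²-part) (≈-sym x²-part) ⟩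
    1-x² ⊛ binomialSum i (suc k) ⊕ X^ 2 ⊛ binomialSum i k ∎
  where
  open ≈-Reasoning
  A₀ Xs Rs : PS
  A₀ = summand (suc k) (+ 1) (suc i) 0
  Xs = sumₚ (suc i) (λ j → summand (suc k) (+ (i C j)) (i ∸ j) (suc j))
  Rs = sumₚ i (λ j → summand (suc k) (+ (i C suc j)) (suc (i ∸ suc j)) (suc j))
  regroup : ∀ a x r → a ℤ.+ (x ℤ.+ (r ℤ.+ + 0)) ≡ a ℤ.+ r ℤ.+ x
  regroup = ℤ-Solver.solve-∀
  last-vanishes : summand (suc k) (+ (i C suc i)) (i ∸ i) (suc i) ≈ 𝟘
  last-vanishes = ≈-trans (coefficientwise λ n → cong (λ c → summand (suc k) (+ c) (i ∸ i) (suc i) n) (k>n⇒nCk≡0 (n<1+n i)))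
                          (summand-0 (suc k) (i ∸ i) (suc i))
  pascal : sumₚ (suc i) (λ j → summand (suc k) (+ (suc i C suc j)) (i ∸ j) (suc j)) ≈ Xs ⊕ (Rs ⊕ 𝟘)
  pascal = begin
      sumₚ (suc i) (λ j → summand (suc k) (+ (suc i C suc j)) (i ∸ j) (suc j))
    ≈⟨ sumₚ-cong (suc i) (λ j _ → ≈-trans (coefficientwise λ n → cong (λ c → summand (suc k) (+ c) (i ∸ j) (suc j) n)
                                                                           (sym (nCk+nC[k+1]≡[n+1]C[k+1] i j)))
                                         (summand-+ (suc k) (i C j) (i C suc j) (i ∸ j) (suc j))) ⟩
      sumₚ (suc i) (λ j → summand (suc k) (+ (i C j)) (i ∸ j) (suc j) ⊕ summand (suc k) (+ (i C suc j)) (i ∸ j) (suc j))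
    ≈⟨ sumₚ-distrib-⊕ (suc i) (λ j → summand (suc k) (+ (i C j)) (i ∸ j) (suc j)) (λ j → summand (suc k) (+ (i C suc j)) (i ∸ j) (suc j)) ⟩
      Xs ⊕ sumₚ (suc i) (λ j → summand (suc k) (+ (i C suc j)) (i ∸ j) (suc j))
    ≈⟨ ⊕-congʳ Xs (sumₚ-snoc i (λ j → summand (suc k) (+ (i C suc j)) (i ∸ j) (suc j))) ⟩
      Xs ⊕ (sumₚ i (λ j → summand (suc k) (+ (i C suc j)) (i ∸ j) (suc j)) ⊕ summand (suc k) (+ (i C suc i)) (i ∸ i) (suc i))
    ≈⟨ ⊕-congʳ Xs (⊕-cong (sumₚ-cong i (λ j j<i → coefficientwise λ n →
                              cong (λ p → summand (suc k) (+ (i C suc j)) p (suc j) n) (m∸n≡suc[m∸[1+n]] j<i)))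
                          last-vanishes) ⟩
      Xs ⊕ (Rs ⊕ 𝟘)
    ∎
  1-x²-part : 1-x² ⊛ binomialSum i (suc k) ≈ A₀ ⊕ Rs
  1-x²-part = ≈-trans (⊛-sumₚ (suc i) 1-x² (λ j → summand (suc k) (+ (i C j)) (i ∸ j) j))
                      (sumₚ-cong (suc i) (λ j _ → 1-x²-summand (suc k) (+ (i C j)) (i ∸ j) j))
  x²-part : X^ 2 ⊛ binomialSum i k ≈ Xs
  x²-part = ≈-trans (⊛-sumₚ (suc i) (X^ 2) (λ j → summand k (+ (i C j)) (i ∸ j) j))
                    (sumₚ-cong (suc i) (λ j _ → X²-summand k (+ (i C j)) (i ∸ j) j))

G≈binomialSum : ∀ {i k} → i < k → G i k ≈ binomialSum i k
G≈binomialSum {zero}  {suc k} _ = begin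
    G 0 (suc k)                ≈⟨ G-base k ⟩
    X^ 1 ⊛ W (suc k)           ≈⟨ ⊛-congˡ (W (suc k)) (≈-sym (≈-trans (⊛-congˡ (X^ 1) (·-identityˡ 𝟙)) (⊛-identityˡ (X^ 1)))) ⟩
    summand (suc k) (+ 1) 0 0  ≈⟨ ≈-sym (⊕-identityʳ (summand (suc k) (+ 1) 0 0)) ⟩
    binomialSum 0 (suc k)      ∎
  where open ≈-Reasoning
G≈binomialSum {suc i} {suc k} (s≤s i<k) =
  ≈-trans (G-step i<k)
    (≈-trans (⊕-cong (⊛-congʳ 1-x² (G≈binomialSum (m<n⇒m<1+n i<k))) (⊛-congʳ (X^ 2) (G≈binomialSum i<k)))
             (≈-sym (binomialSum-step i k)))

sumₚ-binomialSum : ∀ k → sumₚ k (λ i → binomialSum i k) ≈ Σₚ (range 0 k) (λ j →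
                     Σₚ (range j k) (λ i → (+ (i C j)) · (1-x² ^ₚ (i ∸ j))) ⊛ X^ (2 * j + 1) ⊛ W (k ∸ j))
sumₚ-binomialSum k = begin
    sumₚ k (λ i → sumₚ (suc i) (term i))                  ≈⟨ ≈-sym (sumₚ-triangle k term) ⟩
    sumₚ k (λ j → sumₚ (k ∸ j) (λ t → term (j + t) j))    ≈⟨ sumₚ-cong k (λ j _ → ≈-sym (column j)) ⟩
    sumₚ k column-sum                                      ≈⟨ ≈-sym (Σₚ-range 0 k column-sum) ⟩
    Σₚ (range 0 k) column-sum                              ∎
  where
  open ≈-Reasoning
  term : ℕ → ℕ → PS
  term i j = summand k (+ (i C j)) (i ∸ j) j
  coefficient : ℕ → ℕ → PS
  coefficient j i = (+ (i C j)) · (1-x² ^ₚ (i ∸ j))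
  column-sum : ℕ → PS
  column-sum j = Σₚ (range j k) (coefficient j) ⊛ X^ (2 * j + 1) ⊛ W (k ∸ j)
  column : ∀ j → column-sum j ≈ sumₚ (k ∸ j) (λ t → term (j + t) j)
  column j = begin
      Σₚ (range j k) (coefficient j) ⊛ Xⱼ ⊛ Wⱼ
    ≈⟨ ⊛-congˡ Wⱼ (⊛-congˡ Xⱼ (Σₚ-range j k (coefficient j))) ⟩
      sumₚ (k ∸ j) ((λ t → coefficient j (j + t))) ⊛ Xⱼ ⊛ Wⱼ
    ≈⟨ ⊛-congˡ Wⱼ (sumₚ-⊛ (k ∸ j) ((λ t → coefficient j (j + t))) Xⱼ) ⟩
      sumₚ (k ∸ j) (λ t → coefficient j (j + t) ⊛ Xⱼ) ⊛ Wⱼ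
    ≈⟨ sumₚ-⊛ (k ∸ j) (λ t → coefficient j (j + t) ⊛ Xⱼ) Wⱼ ⟩
      sumₚ (k ∸ j) (λ t → term (j + t) j)
    ∎
    where
    Xⱼ = X^ (2 * j + 1)
    Wⱼ = W (k ∸ j)

theorem4p3 : (k : ℕ) → (n : ℕ) →
    W k n ≡ (𝟙 ⊕ Σₚ (range 0 k) (λ j →
    Σₚ (range j k) (λ i → (+ (i C j)) · (1-x² ^ₚ (i ∸ j)))
    ⊛ X^ (2 * j + 1) ⊛ W (k ∸ j))) n
theorem4p3 k = coeff (begin
    W k                                  ≈⟨ W≈𝟙⊕sumG k ⟩
    𝟙 ⊕ sumₚ k (λ i → G i k)             ≈⟨ ⊕-congʳ 𝟙 (sumₚ-cong k (λ i i<k → G≈binomialSum i<k)) ⟩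
    𝟙 ⊕ sumₚ k (λ i → binomialSum i k)   ≈⟨ ⊕-congʳ 𝟙 (sumₚ-binomialSum k) ⟩
    𝟙 ⊕ Σₚ (range 0 k) (λ j → Σₚ (range j k) (λ i → (+ (i C j)) · (1-x² ^ₚ (i ∸ j))) ⊛ X^ (2 * j + 1) ⊛ W (k ∸ j)) ∎)
  where open ≈-Reasoning
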